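{- Let $k\in\mathbb{N}$ be even and let $m,n$ be odd integers. Then $K_{k,2}(n,m)=2K_{k,1}\left(\frac{n}{2},\frac{m}{2}\right)$.
   Context: For even $k\in\mathbb{N}$ put $k^*:=4k$ if $\gcd(k,6)=2$ and $k^*:=36k$ if $6\mid k$. For $a\in\{1,2\}$ and $n,m\in\frac12\mathbb{Z}$ define $$K_{k,a}(n,m):= \sum_{\substack{0\leq h<ak\\ \gcd(h,ak)=1 }}e^{\frac{2\pi i}{ak} \left(-nh+mh' \right)},$$ where for each $h$, $h'$ denotes an integer with $hh'\equiv -1 \pmod{k^*}$. -}

module Defs where

open import Level using (Level)
open import Data.Nat as ℕ using (ℕ; _/_)
open import Data.Nat.Divisibility as ℕD using ()
open import Data.Nat.Coprimality using (Coprime; coprime?)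
open import Data.Integer as ℤ using (ℤ; +_; -[1+_])
open import Data.List using (List; filter; upTo; foldr)
open import Relation.Nullary.Decidable using (does)
open import Data.Bool using (true; false)
open import Algebra.Bundles using (CommutativeRing)

-- k* : for even k, k* = 4k if gcd(k,6)=2 (i.e. 3 ∤ k) and k* = 36k if 6 ∣ k.
kstar : ℕ → ℕ
kstar k with does (3 ℕD.∣? k)
... | true  = 36 ℕ.* k
... | false = 4 ℕ.* k

module _ {c ℓ : Level} (R : CommutativeRing c ℓ) where
  open CommutativeRing R

  pow : Carrier → ℕ → Carrier
  pow x ℕ.zero = 1#
  pow x (ℕ.suc n) = x * pow x n

  zpow : Carrier → Carrier → ℤ → Carrier
  zpow ω ω⁻ (+ n)    = pow ω n
  zpow ω ω⁻ -[1+ n ] = pow ω⁻ (ℕ.suc n)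

  -- Kloosterman sum K_{k,a}(n,m) with half-integer arguments n = n₂/2, m = m₂/2
  -- (n₂, m₂ ∈ ℤ), evaluated in R where ω plays the role of e^{2πi/(4k)}.
  -- Since e^{2πi x/(ak)} with x = (-n h + m h') = (-n₂ h + m₂ h')/2, we get
  -- e^{2πi x/(ak)} = ω^{(-n₂ h + m₂ h') · (2/a)}   for a ∈ {1,2}.
  -- h' is given by a choice function inv : ℕ → ℤ.
  K : (ω ω⁻ : Carrier) (k a : ℕ) .{{_ : ℕ.NonZero a}} (n₂ m₂ : ℤ) (inv : ℕ → ℤ) → Carrier
  K ω ω⁻ k a n₂ m₂ inv =
    foldr (λ h acc → zpow ω ω⁻ ((ℤ.- (n₂ ℤ.* + h) ℤ.+ m₂ ℤ.* inv h) ℤ.* + (2 / a)) + acc)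
          0#
          (filter (λ h → coprime? h (a ℕ.* k)) (upTo (a ℕ.* k)))

{-# OPTIONS --safe #-}
-- Both Kloosterman sums have summands ω^(2 (-n h + m h′)) with ω of order dividing 4k, so
-- only the phase -n h + m h′ modulo 2k matters, and h′ only modulo 2k.  Split 0 ≤ h < 2k into
-- h = i and h = k + i with 0 ≤ i < k; since k is even, h is a unit modulo 2k exactly when i is
-- a unit modulo k.  For h = i the inverses modulo 2k agree, so the phases agree.  For h = k + i
-- the odd i satisfies (k + i)(i′ + k) ≡ i i′ (mod 2k), so (k + i)′ ≡ i′ + k and the phase
-- changes by k (m - n), which vanishes modulo 2k because n and m are odd.

module Submission where

open import Defs
open import Level using (Level)
open import Data.Nat as ℕ using (ℕ; _<_; zero; suc; s≤s)
open import Data.Nat.Divisibility as ℕD using ()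
open import Data.Nat.Coprimality using (Coprime)
open import Data.Integer as ℤ using (ℤ; +_; -[1+_])
open import Data.Integer.Divisibility as ℤD using ()
open import Relation.Nullary using (¬_)
open import Algebra.Bundles using (CommutativeRing; Monoid)

open import Data.Bool using (true; false)
open import Data.List using (List; []; _∷_; _++_; map; filter; foldr; applyUpTo; upTo)
open import Data.List.Membership.Propositional using (_∈_)
open import Data.List.Membership.Propositional.Properties using (∈-upTo⁻)
open import Data.List.Relation.Unary.Any using (here; there)
import Data.List.Properties as ListP
import Data.Nat.Properties as ℕP
import Data.Nat.Coprimality as ℕC
import Data.Integer.Properties as ℤP
import Data.Integer.DivMod as ℤDM
import Data.Integer.Coprimality as ℤC
open import Data.Integer.Divisibility.Signed as ℤS
  using (divides; ∣m∣n⇒∣m+n; ∣m∣n⇒∣m-n; ∣n⇒∣m*n; *-monoʳ-∣; *-monoˡ-∣; ∣ᵤ⇒∣; ∣⇒∣ᵤ)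
open import Data.Integer.Tactic.RingSolver using (solve-∀)
open import Data.Product using (Σ; _,_)
open import Function using (_∘_; id; _⇔_; mk⇔; Equivalence)
open import Function.Construct.Composition using (_⇔-∘_)
open import Relation.Nullary using (yes; no; does; contradiction)
open import Relation.Unary using (Pred; Decidable)
import Relation.Binary.PropositionalEquality as ≡
open ≡ using (_≡_; subst; subst₂)

module _ {h k : ℕ} where
  open import Data.Nat.Base using (_*_; _+_)

  coprime-2*⁻ : Coprime h (2 * k) → Coprime h k
  coprime-2*⁻ c (d∣h , d∣k) = c (d∣h , ℕD.∣n⇒∣m*n 2 d∣k)

  -- A divisor of h and 2k is coprime to k and divides k * k (k is even), so it divides k.
  coprime-2*⁺ : 2 ℕD.∣ k → Coprime h k → Coprime h (2 * k)
  coprime-2*⁺ 2∣k c {d} (d∣h , d∣2k) =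
    c (d∣h , ℕC.coprime-divisor d⊥k (ℕD.∣-trans d∣2k (ℕD.*-monoˡ-∣ k 2∣k)))
    where
      d⊥k : Coprime d k
      d⊥k (e∣d , e∣k) = c (ℕD.∣-trans e∣d d∣h , e∣k)

  coprime-2*⇔ : 2 ℕD.∣ k → Coprime h (2 * k) ⇔ Coprime h k
  coprime-2*⇔ 2∣k = mk⇔ coprime-2*⁻ (coprime-2*⁺ 2∣k)

  coprime-+⇔ : Coprime (k + h) k ⇔ Coprime h k
  coprime-+⇔ = mk⇔ (λ c {_} (d∣h , d∣k) → c (ℕD.∣m∣n⇒∣m+n d∣k d∣h , d∣k)) ℕC.coprime-+

  coprime-even⇒odd : 2 ℕD.∣ k → Coprime h k → ¬ 2 ℕD.∣ h
  coprime-even⇒odd 2∣k c 2∣h with () ← c (2∣h , 2∣k)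

module _ where
  open import Data.Integer.Base using (_+_; _-_; _*_; _⊖_)
  open ℤS using (_∣_)

  ¬2∣x⇒2∣x+1 : ∀ {x} → ¬ (+ 2 ∣ x) → + 2 ∣ x + + 1
  ¬2∣x⇒2∣x+1 {x} 2∤x with x ℤ.% + 2 | ℤDM.a≡a%n+[a/n]*n x (+ 2) | ℤDM.n%d<d x (+ 2)
  ... | 0 | x≡ | _ = contradiction (divides (x ℤ./ + 2) (≡.trans x≡ (ℤP.+-identityˡ _))) 2∤x
  ... | 1 | x≡ | _ = divides (x ℤ./ + 2 + + 1) (≡.trans (≡.cong (_+ + 1) x≡) (rearrange (x ℤ./ + 2)))
    where
      rearrange : ∀ q → (+ 1 + q * + 2) + + 1 ≡ (q + + 1) * + 2
      rearrange = solve-∀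
  ... | suc (suc _) | _ | s≤s (s≤s ())

  ¬2∣m⇒¬2∣n⇒2∣m-n : ∀ {m n} → ¬ (+ 2 ∣ m) → ¬ (+ 2 ∣ n) → + 2 ∣ m - n
  ¬2∣m⇒¬2∣n⇒2∣m-n {m} {n} 2∤m 2∤n =
    subst (+ 2 ∣_) (shift m n) (∣m∣n⇒∣m-n (¬2∣x⇒2∣x+1 2∤m) (¬2∣x⇒2∣x+1 2∤n))
    where
      shift : ∀ m n → (m + + 1) - (n + + 1) ≡ m - n
      shift = solve-∀

  NegInverseMod : ℤ → ℤ → ℤ → Set
  NegInverseMod d h a = d ∣ h * a + + 1

  negInverse-unique : ∀ {d h a b} → ℤC.Coprime h d →
                      NegInverseMod d h a → NegInverseMod d h b → d ∣ a - b
  negInverse-unique {d} {h} {a} {b} h⊥d d∣ha+1 d∣hb+1 =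
    ∣ᵤ⇒∣ (ℤC.coprime-divisor d h (a - b) (ℤC.sym {h} {d} h⊥d) (∣⇒∣ᵤ d∣h[a-b]))
    where
      difference : ∀ h a b → (h * a + + 1) - (h * b + + 1) ≡ h * (a - b)
      difference = solve-∀
      d∣h[a-b] : d ∣ h * (a - b)
      d∣h[a-b] = subst (d ∣_) (difference h a b) (∣m∣n⇒∣m-n d∣ha+1 d∣hb+1)

  -- The cross terms (i + b) κ and κ κ are multiples of 2κ.
  negInverse-shift : ∀ {κ i b} → + 2 ∣ κ → + 2 ∣ i + + 1 →
                     NegInverseMod (+ 2 * κ) i b → NegInverseMod (+ 2 * κ) (κ + i) (b + κ)
  negInverse-shift {κ} {i} {b} 2∣κ 2∣i+1 inv =
    subst (+ 2 * κ ∣_) (expand κ i b)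
      (∣m∣n⇒∣m+n (∣m∣n⇒∣m+n inv (*-monoˡ-∣ κ 2∣i+b)) (*-monoˡ-∣ κ 2∣κ))
    where
      expand : ∀ κ i b → (i * b + + 1) + (i + b) * κ + κ * κ ≡ (κ + i) * (b + κ) + + 1
      expand = solve-∀
      i+b : ∀ i b → (i + + 1) * (b + + 1) - (i * b + + 1) ≡ i + b
      i+b = solve-∀
      2∣i+b : + 2 ∣ i + b
      2∣i+b = subst (+ 2 ∣_) (i+b i b)
        (∣m∣n⇒∣m-n (ℤS.∣m⇒∣m*n (b + + 1) 2∣i+1) (ℤS.∣-trans (ℤS.∣m⇒∣m*n κ ℤS.∣-refl) inv))

  ⊖-surjective : ∀ x → Σ ℕ λ a → Σ ℕ λ b → x ≡ a ⊖ b
  ⊖-surjective (+ a)    = a , 0 , ≡.refl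
  ⊖-surjective -[1+ b ] = 0 , suc b , ≡.refl

  ⊖-+-⊖ : ∀ a b c d → (a ⊖ b) + (c ⊖ d) ≡ (a ℕ.+ c) ⊖ (b ℕ.+ d)
  ⊖-+-⊖ a b c d = begin
    (a ⊖ b) + (c ⊖ d)          ≡⟨ ≡.cong₂ _+_ (ℤP.[+m]-[+n]≡m⊖n a b) (ℤP.[+m]-[+n]≡m⊖n c d) ⟨
    (+ a - + b) + (+ c - + d)  ≡⟨ regroup (+ a) (+ b) (+ c) (+ d) ⟩
    (+ a + + c) - (+ b + + d)  ≡⟨ ℤP.[+m]-[+n]≡m⊖n (a ℕ.+ c) (b ℕ.+ d) ⟩
    (a ℕ.+ c) ⊖ (b ℕ.+ d)      ∎
    where
      open ≡.≡-Reasoning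
      regroup : ∀ a b c d → (a - b) + (c - d) ≡ (a + c) - (b + d)
      regroup = solve-∀

applyUpTo-+ : ∀ {A : Set} (f : ℕ → A) m n →
              applyUpTo f (m ℕ.+ n) ≡ applyUpTo f m ++ applyUpTo (f ∘ (m ℕ.+_)) n
applyUpTo-+ f zero    n = ≡.refl
applyUpTo-+ f (suc m) n = ≡.cong (f 0 ∷_) (applyUpTo-+ (f ∘ suc) m n)

upTo-+ : ∀ m n → upTo (m ℕ.+ n) ≡ upTo m ++ map (m ℕ.+_) (upTo n)
upTo-+ m n = ≡.trans (applyUpTo-+ id m n) (≡.cong (upTo m ++_) (≡.sym (ListP.map-applyUpTo id (m ℕ.+_) n)))

module ListSum {c ℓ} (M : Monoid c ℓ) where
  open Monoid M

  sumMap : ∀ {A : Set} → (A → Carrier) → List A → Carrier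
  sumMap f = foldr (λ x acc → f x ∙ acc) ε

  sumMap-++ : ∀ {A : Set} (f : A → Carrier) xs ys → sumMap f (xs ++ ys) ≈ sumMap f xs ∙ sumMap f ys
  sumMap-++ f []       ys = sym (identityˡ _)
  sumMap-++ f (x ∷ xs) ys = trans (∙-congˡ (sumMap-++ f xs ys)) (sym (assoc _ _ _))

  sumMap-filter-map : ∀ {A B : Set} {p q} {P : Pred B p} {Q : Pred A q}
    (P? : Decidable P) (Q? : Decidable Q) (g : A → B) {f : B → Carrier} {f′ : A → Carrier} xs →
    (∀ {x} → x ∈ xs → P (g x) ⇔ Q x) → (∀ {x} → x ∈ xs → Q x → f (g x) ≈ f′ x) →
    sumMap f (filter P? (map g xs)) ≈ sumMap f′ (filter Q? xs)
  sumMap-filter-map P? Q? g []       P⇔Q f≈f′ = refl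
  sumMap-filter-map P? Q? g (x ∷ xs) P⇔Q f≈f′ with P? (g x) | Q? x
  ... | yes p | yes q =
    ∙-cong (f≈f′ (here ≡.refl) q) (sumMap-filter-map P? Q? g xs (P⇔Q ∘ there) (f≈f′ ∘ there))
  ... | yes p | no ¬q = contradiction (Equivalence.to (P⇔Q (here ≡.refl)) p) ¬q
  ... | no ¬p | yes q = contradiction (Equivalence.from (P⇔Q (here ≡.refl)) q) ¬p
  ... | no _  | no _  = sumMap-filter-map P? Q? g xs (P⇔Q ∘ there) (f≈f′ ∘ there)

module IntegerPower {c ℓ} (R : CommutativeRing c ℓ) where
  open CommutativeRing R
  open import Relation.Binary.Reasoning.Setoid setoid
  open import Algebra.Properties.CommutativeSemigroup *-commutativeSemigroup using (interchange)

  pow-homo-+ : ∀ x a b → pow R x (a ℕ.+ b) ≈ pow R x a * pow R x b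
  pow-homo-+ x zero    b = sym (*-identityˡ _)
  pow-homo-+ x (suc a) b = trans (*-congˡ (pow-homo-+ x a b)) (sym (*-assoc _ _ _))

  pow-multiple≈1 : ∀ {x N} → pow R x N ≈ 1# → ∀ j → pow R x (j ℕ.* N) ≈ 1#
  pow-multiple≈1         x^N≈1 zero    = refl
  pow-multiple≈1 {x} {N} x^N≈1 (suc j) = begin
    pow R x (N ℕ.+ j ℕ.* N)       ≈⟨ pow-homo-+ x N (j ℕ.* N) ⟩
    pow R x N * pow R x (j ℕ.* N) ≈⟨ *-cong x^N≈1 (pow-multiple≈1 x^N≈1 j) ⟩
    1# * 1#                       ≈⟨ *-identityˡ 1# ⟩
    1#                            ∎

  module _ {ω ω⁻ : Carrier} (ωω⁻≈1 : ω * ω⁻ ≈ 1#) where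
    private
      ω^ : ℤ → Carrier
      ω^ = zpow R ω ω⁻

    zpow-⊖ : ∀ a b → ω^ (a ℤ.⊖ b) ≈ pow R ω a * pow R ω⁻ b
    zpow-⊖ a       zero    = sym (*-identityʳ _)
    zpow-⊖ zero    (suc b) = sym (*-identityˡ _)
    zpow-⊖ (suc a) (suc b) = begin
      ω^ (suc a ℤ.⊖ suc b)                 ≡⟨ ≡.cong ω^ (ℤP.[1+m]⊖[1+n]≡m⊖n a b) ⟩
      ω^ (a ℤ.⊖ b)                         ≈⟨ zpow-⊖ a b ⟩
      pow R ω a * pow R ω⁻ b               ≈⟨ *-identityˡ _ ⟨
      1# * (pow R ω a * pow R ω⁻ b)        ≈⟨ *-congʳ ωω⁻≈1 ⟨
      (ω * ω⁻) * (pow R ω a * pow R ω⁻ b)  ≈⟨ interchange ω ω⁻ _ _ ⟩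
      (ω * pow R ω a) * (ω⁻ * pow R ω⁻ b)  ∎

    zpow-homo-+ : ∀ x y → ω^ (x ℤ.+ y) ≈ ω^ x * ω^ y
    zpow-homo-+ x y with ⊖-surjective x | ⊖-surjective y
    ... | a , b , ≡.refl | c , d , ≡.refl = begin
      ω^ ((a ℤ.⊖ b) ℤ.+ (c ℤ.⊖ d))                        ≡⟨ ≡.cong ω^ (⊖-+-⊖ a b c d) ⟩
      ω^ ((a ℕ.+ c) ℤ.⊖ (b ℕ.+ d))                        ≈⟨ zpow-⊖ (a ℕ.+ c) (b ℕ.+ d) ⟩
      pow R ω (a ℕ.+ c) * pow R ω⁻ (b ℕ.+ d)              ≈⟨ *-cong (pow-homo-+ ω a c) (pow-homo-+ ω⁻ b d) ⟩
      (pow R ω a * pow R ω c) * (pow R ω⁻ b * pow R ω⁻ d) ≈⟨ interchange _ _ _ _ ⟩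
      (pow R ω a * pow R ω⁻ b) * (pow R ω c * pow R ω⁻ d) ≈⟨ *-cong (zpow-⊖ a b) (zpow-⊖ c d) ⟨
      ω^ (a ℤ.⊖ b) * ω^ (c ℤ.⊖ d)                         ∎

    zpow-multiple≈1 : ∀ {N} → pow R ω N ≈ 1# → ∀ q → ω^ (q ℤ.* + N) ≈ 1#
    zpow-multiple≈1 {N} ω^N≈1 (+ j) = begin
      ω^ (+ j ℤ.* + N)   ≡⟨ ≡.cong ω^ (ℤP.pos-* j N) ⟨
      pow R ω (j ℕ.* N)  ≈⟨ pow-multiple≈1 ω^N≈1 j ⟩
      1#                 ∎
    zpow-multiple≈1 {N} ω^N≈1 -[1+ j ] = begin
      ω^ (-[1+ j ] ℤ.* + N)          ≡⟨ ≡.cong ω^ (ℤP.neg-distribˡ-* (+ suc j) (+ N)) ⟨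
      ω^ (ℤ.- z)                     ≈⟨ *-identityʳ _ ⟨
      ω^ (ℤ.- z) * 1#                ≈⟨ *-congˡ (zpow-multiple≈1 {N} ω^N≈1 (+ suc j)) ⟨
      ω^ (ℤ.- z) * ω^ z              ≈⟨ zpow-homo-+ (ℤ.- z) z ⟨
      ω^ (ℤ.- z ℤ.+ z)               ≡⟨ ≡.cong ω^ (ℤP.+-inverseˡ z) ⟩
      1#                             ∎
      where z = + suc j ℤ.* + N

    zpow-periodic : ∀ {N x y} → pow R ω N ≈ 1# → + N ℤS.∣ x ℤ.- y → ω^ x ≈ ω^ y
    zpow-periodic {N} {x} {y} ω^N≈1 (divides q x-y≡qN) = begin
      ω^ x                   ≡⟨ ≡.cong ω^ (≡.trans (x≡y+[x-y] x y) (≡.cong (λ z → y ℤ.+ z) x-y≡qN)) ⟩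
      ω^ (y ℤ.+ q ℤ.* + N)   ≈⟨ zpow-homo-+ y (q ℤ.* + N) ⟩
      ω^ y * ω^ (q ℤ.* + N)  ≈⟨ *-congˡ (zpow-multiple≈1 ω^N≈1 q) ⟩
      ω^ y * 1#              ≈⟨ *-identityʳ _ ⟩
      ω^ y                   ∎
      where
        x≡y+[x-y] : ∀ x y → x ≡ y ℤ.+ (x ℤ.- y)
        x≡y+[x-y] = solve-∀

module KloostermanDoubling {c ℓ} (R : CommutativeRing c ℓ) where
  private module R = CommutativeRing R
  open R using (Carrier; _≈_; setoid; +-monoid)
  open ListSum +-monoid
  open IntegerPower R
  open import Relation.Binary.Reasoning.Setoid setoid
  open import Data.Integer.Base using (_+_; _-_; _*_; -_)
  open ℤS using (_∣_)

  module _ {k : ℕ} (2∣k : 2 ℕD.∣ k)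
    {ω ω⁻ : Carrier} (ωω⁻≈1 : ω R.* ω⁻ ≈ R.1#) (ω^4k≈1 : pow R ω (4 ℕ.* k) ≈ R.1#)
    (n m : ℤ) (2∤n : ¬ (+ 2 ℤS.∣ n)) (2∤m : ¬ (+ 2 ℤS.∣ m))
    (inv₁ inv₂ : ℕ → ℤ)
    (inv₁-spec : ∀ {h} → h < k → Coprime h k → NegInverseMod (+ 2 ℤ.* + k) (+ h) (inv₁ h))
    (inv₂-spec : ∀ {h} → h < 2 ℕ.* k → Coprime h (2 ℕ.* k) → NegInverseMod (+ 2 ℤ.* + k) (+ h) (inv₂ h))
    where

    private
      κ 2κ : ℤ
      κ  = + k
      2κ = + 2 * κ

    phase : ℕ → ℤ → ℤ
    phase h a = - (n * + h) + m * a

    exponent₂ exponent₁ : ℕ → ℤ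
    exponent₂ h = (- (+ 2 * n * + h) + + 2 * m * inv₂ h) * + 1
    exponent₁ h = (- (n * + h) + m * inv₁ h) * + 2

    term₂ term₁ : ℕ → Carrier
    term₂ h = zpow R ω ω⁻ (exponent₂ h)
    term₁ h = zpow R ω ω⁻ (exponent₁ h)

    term-cong : ∀ {h i} → 2κ ∣ phase h (inv₂ h) - phase i (inv₁ i) → term₂ h ≈ term₁ i
    term-cong {h} {i} 2κ∣ = zpow-periodic ωω⁻≈1 {4 ℕ.* k} {exponent₂ h} {exponent₁ i} ω^4k≈1
      (subst₂ _∣_ 4k≡ (doubled n m (+ h) (inv₂ h) (+ i) (inv₁ i)) (*-monoʳ-∣ (+ 2) 2κ∣))
      where
        4k≡ : + 2 * 2κ ≡ + (4 ℕ.* k)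
        4k≡ = ≡.trans (≡.sym (ℤP.*-assoc (+ 2) (+ 2) κ)) (≡.sym (ℤP.pos-* 4 k))
        doubled : ∀ n m h a i b → + 2 * ((- (n * h) + m * a) - (- (n * i) + m * b))
                                ≡ (- (+ 2 * n * h) + + 2 * m * a) * + 1 - (- (n * i) + m * b) * + 2
        doubled = solve-∀

    ℤ-coprime-2k : ∀ {h} → Coprime h (2 ℕ.* k) → ℤC.Coprime (+ h) 2κ
    ℤ-coprime-2k = subst (ℤC.Coprime (+ _)) (ℤP.pos-* 2 k)

    lower-term : ∀ {i} → i < k → Coprime i k → term₂ i ≈ term₁ i
    lower-term {i} i<k i⊥k =
      term-cong {i} {i} (subst (2κ ∣_) (difference n m (+ i) (inv₂ i) (inv₁ i)) (∣n⇒∣m*n m a≡b))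
      where
        i⊥2k = coprime-2*⁺ 2∣k i⊥k
        a≡b : 2κ ∣ inv₂ i - inv₁ i
        a≡b = negInverse-unique {h = + i} (ℤ-coprime-2k i⊥2k)
                (inv₂-spec (ℕP.<-≤-trans i<k (ℕP.m≤n*m k 2)) i⊥2k) (inv₁-spec i<k i⊥k)
        difference : ∀ n m i a b → m * (a - b) ≡ (- (n * i) + m * a) - (- (n * i) + m * b)
        difference = solve-∀

    upper-term : ∀ {i} → i < k → Coprime i k → term₂ (k ℕ.+ i) ≈ term₁ i
    upper-term {i} i<k i⊥k = term-cong {k ℕ.+ i} {i}
      (subst (2κ ∣_) (difference n m κ (+ i) (inv₂ (k ℕ.+ i)) (inv₁ i))
        (∣m∣n⇒∣m+n (∣n⇒∣m*n m a≡b+κ) (*-monoˡ-∣ κ (¬2∣m⇒¬2∣n⇒2∣m-n 2∤m 2∤n))))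
      where
        k+i⊥2k = coprime-2*⁺ 2∣k (Equivalence.from coprime-+⇔ i⊥k)
        2∣i+1 : + 2 ∣ + i + + 1
        2∣i+1 = ¬2∣x⇒2∣x+1 {+ i} (coprime-even⇒odd 2∣k i⊥k ∘ ∣⇒∣ᵤ)
        a≡b+κ : 2κ ∣ inv₂ (k ℕ.+ i) - (inv₁ i + κ)
        a≡b+κ = negInverse-unique {h = + (k ℕ.+ i)} (ℤ-coprime-2k k+i⊥2k)
                  (inv₂-spec (ℕP.+-monoʳ-< k (ℕP.<-≤-trans i<k (ℕP.m≤m+n k 0))) k+i⊥2k)
                  (negInverse-shift {κ} {+ i} (∣ᵤ⇒∣ 2∣k) 2∣i+1 (inv₁-spec i<k i⊥k))
        difference : ∀ n m κ i a b → m * (a - (b + κ)) + (m - n) * κ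
                                   ≡ (- (n * (κ + i)) + m * a) - (- (n * i) + m * b)
        difference = solve-∀

    K-doubling : K R ω ω⁻ k 2 (+ 2 * n) (+ 2 * m) inv₂ ≈ K R ω ω⁻ k 1 n m inv₁ R.+ K R ω ω⁻ k 1 n m inv₁
    K-doubling = begin
      sumMap term₂ (filter P? (upTo (2 ℕ.* k)))
        ≡⟨ ≡.cong (sumMap term₂ ∘ filter P?) upTo-2k ⟩
      sumMap term₂ (filter P? (upTo k ++ map (k ℕ.+_) (upTo k)))
        ≡⟨ ≡.cong (sumMap term₂) (ListP.filter-++ P? (upTo k) _) ⟩
      sumMap term₂ (filter P? (upTo k) ++ filter P? (map (k ℕ.+_) (upTo k)))
        ≈⟨ sumMap-++ term₂ (filter P? (upTo k)) _ ⟩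
      sumMap term₂ (filter P? (upTo k)) R.+ sumMap term₂ (filter P? (map (k ℕ.+_) (upTo k)))
        ≈⟨ R.+-cong lower-half upper-half ⟩
      sumMap term₁ (filter Q? (upTo k)) R.+ sumMap term₁ (filter Q? (upTo k))
        ≡⟨ ≡.cong₂ R._+_ K₁≡ K₁≡ ⟨
      K R ω ω⁻ k 1 n m inv₁ R.+ K R ω ω⁻ k 1 n m inv₁ ∎
      where
        P? Q? : Decidable _
        P? h = ℕC.coprime? h (2 ℕ.* k)
        Q? h = ℕC.coprime? h k

        upTo-2k : upTo (2 ℕ.* k) ≡ upTo k ++ map (k ℕ.+_) (upTo k)
        upTo-2k = ≡.trans (≡.cong (upTo ∘ (k ℕ.+_)) (ℕP.+-identityʳ k)) (upTo-+ k k)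

        K₁≡ : K R ω ω⁻ k 1 n m inv₁ ≡ sumMap term₁ (filter Q? (upTo k))
        K₁≡ = ≡.cong (λ N → sumMap term₁ (filter (λ h → ℕC.coprime? h N) (upTo N))) (ℕP.*-identityˡ k)

        lower-half : sumMap term₂ (filter P? (upTo k)) ≈ sumMap term₁ (filter Q? (upTo k))
        lower-half = subst (λ xs → sumMap term₂ (filter P? xs) ≈ sumMap term₁ (filter Q? (upTo k)))
          (ListP.map-id (upTo k))
          (sumMap-filter-map P? Q? id (upTo k) (λ _ → coprime-2*⇔ 2∣k)
            (λ i∈ → lower-term (∈-upTo⁻ i∈)))

        upper-half : sumMap term₂ (filter P? (map (k ℕ.+_) (upTo k))) ≈ sumMap term₁ (filter Q? (upTo k))
        upper-half = sumMap-filter-map P? Q? (k ℕ.+_) (upTo k) (λ _ → coprime-+⇔ ⇔-∘ coprime-2*⇔ 2∣k)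
          (λ i∈ → upper-term (∈-upTo⁻ i∈))

2k∣kstar : ∀ k → 2 ℕ.* k ℕD.∣ kstar k
2k∣kstar k with does (3 ℕD.∣? k)
... | true  = ℕD.*-monoˡ-∣ k (ℕD.divides {2} {36} 18 ≡.refl)
... | false = ℕD.*-monoˡ-∣ k (ℕD.divides {2} {4} 2 ≡.refl)

lemma2p4 : {c ℓ : Level} (R : CommutativeRing c ℓ) →
    let open CommutativeRing R in
    (k : ℕ) → 2 ℕD.∣ k →
    (ω ω⁻ : Carrier) → ω * ω⁻ ≈ 1# → pow R ω (4 ℕ.* k) ≈ 1# → (n m : ℤ) → ¬ (+ 2 ℤD.∣ n) → ¬ (+ 2 ℤD.∣ m) →
    (inv₁ inv₂ : ℕ → ℤ) →
    (∀ h → h < 1 ℕ.* k → Coprime h (1 ℕ.* k) → + (kstar k) ℤD.∣ (+ h ℤ.* inv₁ h ℤ.+ + 1)) →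
    (∀ h → h < 2 ℕ.* k → Coprime h (2 ℕ.* k) → + (kstar k) ℤD.∣ (+ h ℤ.* inv₂ h ℤ.+ + 1)) →
    K R ω ω⁻ k 2 (+ 2 ℤ.* n) (+ 2 ℤ.* m) inv₂ ≈ K R ω ω⁻ k 1 n m inv₁ + K R ω ω⁻ k 1 n m inv₁
lemma2p4 R k 2∣k ω ω⁻ ωω⁻≈1 ω^4k≈1 n m 2∤n 2∤m inv₁ inv₂ inv₁-spec inv₂-spec =
  KloostermanDoubling.K-doubling R 2∣k ωω⁻≈1 ω^4k≈1 n m (2∤n ∘ ∣⇒∣ᵤ) (2∤m ∘ ∣⇒∣ᵤ) inv₁ inv₂
    (λ {h} h<k h⊥k → mod-2k (inv₁-spec h (subst (h <_) 1k≡k h<k) (subst (Coprime h) 1k≡k h⊥k)))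
    (λ {h} h<2k h⊥2k → mod-2k (inv₂-spec h h<2k h⊥2k))
  where
    1k≡k : k ≡ 1 ℕ.* k
    1k≡k = ≡.sym (ℕP.*-identityˡ k)
    mod-2k : ∀ {x} → + (kstar k) ℤD.∣ x → + 2 ℤ.* + k ℤS.∣ x
    mod-2k kstar∣x = subst (ℤS._∣ _) (ℤP.pos-* 2 k) (∣ᵤ⇒∣ (ℕD.∣-trans (2k∣kstar k) kstar∣x))
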